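{- Let $(A,\odot,\rightarrow,\rightsquigarrow,1)$ be a pseudo-hoop. Then $A$ is Archimedean if and only if $A$ is a linearly ordered Wajsberg pseudo-hoop (i.e. a Wajsberg pseudo-hoop whose order $\le$ is total).
   Context: A pseudo-hoop is an algebra $(A,\odot,\rightarrow,\rightsquigarrow,1)$ of type $(2,2,2,0)$ such that for all $x,y,z\in A$: $x\odot 1=1\odot x=x$; $x\rightarrow x=x\rightsquigarrow x=1$; $(x\odot y)\rightarrow z=x\rightarrow(y\rightarrow z)$; $(x\odot y)\rightsquigarrow z=y\rightsquigarrow(x\rightsquigarrow z)$; $(x\rightarrow y)\odot x=(y\rightarrow x)\odot y=x\odot(x\rightsquigarrow y)=y\odot(y\rightsquigarrow x)$. ($\odot$ binds more strongly than $\rightarrow,\rightsquigarrow$.) The relation $x\le y$ iff $x\rightarrow y=1$ (equivalently $x\rightsquigarrow y=1$) is a partial order on $A$. Put $x\vee_1 y=(x\rightarrow y)\rightsquigarrow y$ and $x\vee_2 y=(x\rightsquigarrow y)\rightarrow y$. $A$ is a Wajsberg pseudo-hoop if $x\vee_1 y=y\vee_1 x$ and $x\vee_2 y=y\vee_2 x$ for all $x,y\in A$. $A$ is Archimedean if for all $x,y\in A$: ($y\rightarrow x=x$ implies $x=1$ or $y=1$) and ($y\rightsquigarrow x=x$ implies $x=1$ or $y=1$). -}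

module Defs where

open import Level using (Level; _⊔_) renaming (suc to lsuc)
open import Relation.Binary.PropositionalEquality using (_≡_)
open import Data.Sum using (_⊎_)
open import Data.Product using (_×_)

record PseudoHoop (a : Level) : Set (lsuc a) where
  infixl 7 _⊙_
  infixr 5 _⇒_ _⇝_
  field
    Carrier : Set a
    _⊙_     : Carrier → Carrier → Carrier
    _⇒_     : Carrier → Carrier → Carrier
    _⇝_     : Carrier → Carrier → Carrier
    one     : Carrier
    ⊙-identityʳ : ∀ x → x ⊙ one ≡ x
    ⊙-identityˡ : ∀ x → one ⊙ x ≡ x
    ⇒-refl      : ∀ x → x ⇒ x ≡ one
    ⇝-refl      : ∀ x → x ⇝ x ≡ one
    ⇒-curry     : ∀ x y z → (x ⊙ y) ⇒ z ≡ x ⇒ (y ⇒ z)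
    ⇝-curry     : ∀ x y z → (x ⊙ y) ⇝ z ≡ y ⇝ (x ⇝ z)
    div₁        : ∀ x y → (x ⇒ y) ⊙ x ≡ (y ⇒ x) ⊙ y
    div₂        : ∀ x y → (y ⇒ x) ⊙ y ≡ x ⊙ (x ⇝ y)
    div₃        : ∀ x y → x ⊙ (x ⇝ y) ≡ y ⊙ (y ⇝ x)

module _ {a : Level} (A : PseudoHoop a) where
  open PseudoHoop A

  _≤_ : Carrier → Carrier → Set a
  x ≤ y = x ⇒ y ≡ one

  _∨₁_ : Carrier → Carrier → Carrier
  x ∨₁ y = (x ⇒ y) ⇝ y

  _∨₂_ : Carrier → Carrier → Carrier
  x ∨₂ y = (x ⇝ y) ⇒ y

  IsWajsberg : Set a
  IsWajsberg = (∀ x y → x ∨₁ y ≡ y ∨₁ x) × (∀ x y → x ∨₂ y ≡ y ∨₂ x)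

  IsLinear : Set a
  IsLinear = ∀ x y → (x ≤ y) ⊎ (y ≤ x)

  IsArchimedean : Set a
  IsArchimedean =
    (∀ x y → y ⇒ x ≡ x → (x ≡ one) ⊎ (y ≡ one)) ×
    (∀ x y → y ⇝ x ≡ x → (x ≡ one) ⊎ (y ≡ one))

-- In a pseudo-hoop put w = x ∨₁ y.  Then x ≤ w and x ⇒ y is a fixed point of
-- (w ⇒ x) ⇒ _, so the Archimedean property forces x ≤ y or w ⇒ x = 1, i.e.
-- x ∨₁ y = x.  If neither x ≤ y nor y ≤ x, then x ∨₁ y = x and y ∨₁ x = y
-- make y a fixed point of ((x ⇒ y) ⊙ (y ⇒ x)) ⇝ _, and the Archimedean
-- property again yields x ≤ y: the order is linear.  In a linear pseudo-hoop
-- x ≤ y gives x ∨₁ y = y, and in the Archimedean case also y ∨₁ x = y, so ∨₁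
-- is commutative.  Conversely, if ∨₁ is commutative, the order is linear and
-- y ⇒ x = x with x ≤ y, then y = x ∨₁ y = y ∨₁ x = x ⇝ x = 1.  Everything
-- for ∨₂ and ⇝ follows by passing to the opposite pseudo-hoop.
module Submission where

open import Level using (Level)
open import Data.Product using (_×_; _,_; proj₁; proj₂; swap)
open import Data.Sum using (_⊎_; inj₁; inj₂; [_,_]′; map; map₂)
open import Function using (flip)
open import Function.Bundles using (_⇔_; mk⇔)
open import Relation.Binary.PropositionalEquality
open import Defs using (PseudoHoop; IsWajsberg; IsLinear; IsArchimedean)

-- Swapping ⇒ with ⇝ and reversing ⊙ exchanges the two halves of both the
-- Archimedean and the Wajsberg condition.
opposite : {a : Level} → PseudoHoop a → PseudoHoop a
opposite A = record
  { Carrier     = Carrier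
  ; _⊙_         = flip _⊙_
  ; _⇒_         = _⇝_
  ; _⇝_         = _⇒_
  ; one         = one
  ; ⊙-identityʳ = ⊙-identityˡ
  ; ⊙-identityˡ = ⊙-identityʳ
  ; ⇒-refl      = ⇝-refl
  ; ⇝-refl      = ⇒-refl
  ; ⇒-curry     = λ x y z → ⇝-curry y x z
  ; ⇝-curry     = λ x y z → ⇒-curry y x z
  ; div₁        = div₃
  ; div₂        = λ x y → sym (trans (div₁ x y) (trans (div₂ x y) (div₃ x y)))
  ; div₃        = div₁
  }
  where open PseudoHoop A

module Properties {a : Level} (A : PseudoHoop a) where
  open PseudoHoop A
  open ≡-Reasoning
  open import Algebra.Definitions {A = Carrier} _≡_ using (Commutative)

  infix 4 _≤_
  _≤_ : Carrier → Carrier → Set a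
  _≤_ = Defs._≤_ A

  infixr 6 _∨₁_
  _∨₁_ : Carrier → Carrier → Carrier
  _∨₁_ = Defs._∨₁_ A

  ⇒-Archimedean : Set a
  ⇒-Archimedean = ∀ x y → y ⇒ x ≡ x → x ≡ one ⊎ y ≡ one

  ≤-refl : ∀ x → x ≤ x
  ≤-refl = ⇒-refl

  ≤-antisym : ∀ {x y} → x ≤ y → y ≤ x → x ≡ y
  ≤-antisym {x} {y} x≤y y≤x = begin
    x            ≡⟨ sym (⊙-identityˡ x) ⟩
    one ⊙ x      ≡⟨ cong (_⊙ x) x≤y ⟨
    (x ⇒ y) ⊙ x  ≡⟨ div₁ x y ⟩
    (y ⇒ x) ⊙ y  ≡⟨ cong (_⊙ y) y≤x ⟩
    one ⊙ y      ≡⟨ ⊙-identityˡ y ⟩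
    y            ∎

  [x⇒one]⊙x≡one⇒x : ∀ x → (x ⇒ one) ⊙ x ≡ one ⇒ x
  [x⇒one]⊙x≡one⇒x x = trans (div₁ x one) (⊙-identityʳ (one ⇒ x))

  one⇒[x⇒one]≡x⇒one : ∀ x → one ⇒ (x ⇒ one) ≡ x ⇒ one
  one⇒[x⇒one]≡x⇒one x = trans (sym (⇒-curry one x one)) (cong (_⇒ one) (⊙-identityˡ x))

  [x⇒one]⇒one≡one : ∀ x → (x ⇒ one) ⇒ one ≡ one
  [x⇒one]⇒one≡one x = begin
    q ⇒ one                ≡⟨ cong (_⇒ one) [q⇒one]⊙q≡q ⟨
    ((q ⇒ one) ⊙ q) ⇒ one  ≡⟨ ⇒-curry (q ⇒ one) q one ⟩
    (q ⇒ one) ⇒ (q ⇒ one)  ≡⟨ ⇒-refl (q ⇒ one) ⟩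
    one                    ∎
    where
    q = x ⇒ one
    [q⇒one]⊙q≡q : (q ⇒ one) ⊙ q ≡ q
    [q⇒one]⊙q≡q = trans ([x⇒one]⊙x≡one⇒x q) (one⇒[x⇒one]≡x⇒one x)

  ⇒-identityˡ : ∀ x → one ⇒ x ≡ x
  ⇒-identityˡ x = ≤-antisym one⇒x≤x x≤one⇒x
    where
    one⇒x≤x : one ⇒ x ≤ x
    one⇒x≤x = begin
      (one ⇒ x) ⇒ x        ≡⟨ cong (_⇒ x) ([x⇒one]⊙x≡one⇒x x) ⟨
      ((x ⇒ one) ⊙ x) ⇒ x  ≡⟨ ⇒-curry (x ⇒ one) x x ⟩
      (x ⇒ one) ⇒ (x ⇒ x)  ≡⟨ cong ((x ⇒ one) ⇒_) (⇒-refl x) ⟩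
      (x ⇒ one) ⇒ one      ≡⟨ [x⇒one]⇒one≡one x ⟩
      one                  ∎
    x≤one⇒x : x ≤ one ⇒ x
    x≤one⇒x = trans (sym (⇒-curry x one x)) (trans (cong (_⇒ x) (⊙-identityʳ x)) (⇒-refl x))

  ⇒-zeroʳ : ∀ x → x ⇒ one ≡ one
  ⇒-zeroʳ x = begin
    x ⇒ one                ≡⟨ cong (_⇒ one) [x⇒one]⊙x≡x ⟨
    ((x ⇒ one) ⊙ x) ⇒ one  ≡⟨ ⇒-curry (x ⇒ one) x one ⟩
    (x ⇒ one) ⇒ (x ⇒ one)  ≡⟨ ⇒-refl (x ⇒ one) ⟩
    one                    ∎
    where
    [x⇒one]⊙x≡x : (x ⇒ one) ⊙ x ≡ x
    [x⇒one]⊙x≡x = trans ([x⇒one]⊙x≡one⇒x x) (⇒-identityˡ x)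

  [y⇒x]⊙y≡y⊙[y⇝x] : ∀ x y → (y ⇒ x) ⊙ y ≡ y ⊙ (y ⇝ x)
  [y⇒x]⊙y≡y⊙[y⇝x] x y = trans (div₂ x y) (div₃ x y)

  ⇝-identityˡ : ∀ x → one ⇝ x ≡ x
  ⇝-identityˡ x = begin
    one ⇝ x          ≡⟨ ⊙-identityˡ (one ⇝ x) ⟨
    one ⊙ (one ⇝ x)  ≡⟨ [y⇒x]⊙y≡y⊙[y⇝x] x one ⟨
    (one ⇒ x) ⊙ one  ≡⟨ ⊙-identityʳ (one ⇒ x) ⟩
    one ⇒ x          ≡⟨ ⇒-identityˡ x ⟩
    x                ∎

  x⊙y≤y : ∀ x y → x ⊙ y ≤ y
  x⊙y≤y x y = begin
    (x ⊙ y) ⇒ y  ≡⟨ ⇒-curry x y y ⟩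
    x ⇒ (y ⇒ y)  ≡⟨ cong (x ⇒_) (⇒-refl y) ⟩
    x ⇒ one      ≡⟨ ⇒-zeroʳ x ⟩
    one          ∎

  ⇝-zeroʳ : ∀ x → x ⇝ one ≡ one
  ⇝-zeroʳ x = begin
    x ⇝ one                ≡⟨ cong (_⇝ one) x⊙[x⇝one]≡x ⟨
    (x ⊙ (x ⇝ one)) ⇝ one  ≡⟨ ⇝-curry x (x ⇝ one) one ⟩
    (x ⇝ one) ⇝ (x ⇝ one)  ≡⟨ ⇝-refl (x ⇝ one) ⟩
    one                    ∎
    where
    x⊙[x⇝one]≡x : x ⊙ (x ⇝ one) ≡ x
    x⊙[x⇝one]≡x = begin
      x ⊙ (x ⇝ one)  ≡⟨ [y⇒x]⊙y≡y⊙[y⇝x] one x ⟨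
      (x ⇒ one) ⊙ x  ≡⟨ cong (_⊙ x) (⇒-zeroʳ x) ⟩
      one ⊙ x        ≡⟨ ⊙-identityˡ x ⟩
      x              ∎

  [x⊙y]⇝x≡one : ∀ x y → (x ⊙ y) ⇝ x ≡ one
  [x⊙y]⇝x≡one x y = begin
    (x ⊙ y) ⇝ x  ≡⟨ ⇝-curry x y x ⟩
    y ⇝ (x ⇝ x)  ≡⟨ cong (y ⇝_) (⇝-refl x) ⟩
    y ⇝ one      ≡⟨ ⇝-zeroʳ y ⟩
    one          ∎

  x≤y⇒[y⇒x]⊙y≡x : ∀ {x y} → x ≤ y → (y ⇒ x) ⊙ y ≡ x
  x≤y⇒[y⇒x]⊙y≡x {x} {y} x≤y = begin
    (y ⇒ x) ⊙ y  ≡⟨ div₁ x y ⟨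
    (x ⇒ y) ⊙ x  ≡⟨ cong (_⊙ x) x≤y ⟩
    one ⊙ x      ≡⟨ ⊙-identityˡ x ⟩
    x            ∎

  ≤⇒⇝≡one : ∀ {x y} → x ≤ y → x ⇝ y ≡ one
  ≤⇒⇝≡one {x} {y} x≤y = subst (λ z → z ⇝ y ≡ one) y⊙[y⇝x]≡x ([x⊙y]⇝x≡one y (y ⇝ x))
    where
    y⊙[y⇝x]≡x : y ⊙ (y ⇝ x) ≡ x
    y⊙[y⇝x]≡x = trans (sym ([y⇒x]⊙y≡y⊙[y⇝x] x y)) (x≤y⇒[y⇒x]⊙y≡x x≤y)

  ⇝≡one⇒≤ : ∀ {x y} → x ⇝ y ≡ one → x ≤ y
  ⇝≡one⇒≤ {x} {y} x⇝y≡one = subst (_≤ y) [y⇒x]⊙y≡x (x⊙y≤y (y ⇒ x) y)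
    where
    [y⇒x]⊙y≡x : (y ⇒ x) ⊙ y ≡ x
    [y⇒x]⊙y≡x = trans (div₂ x y) (trans (cong (x ⊙_) x⇝y≡one) (⊙-identityʳ x))

  ≤-trans : ∀ {x y z} → x ≤ y → y ≤ z → x ≤ z
  ≤-trans {x} {y} {z} x≤y y≤z = begin
    x ⇒ z                ≡⟨ cong (_⇒ z) (x≤y⇒[y⇒x]⊙y≡x x≤y) ⟨
    ((y ⇒ x) ⊙ y) ⇒ z    ≡⟨ ⇒-curry (y ⇒ x) y z ⟩
    (y ⇒ x) ⇒ (y ⇒ z)    ≡⟨ cong ((y ⇒ x) ⇒_) y≤z ⟩
    (y ⇒ x) ⇒ one        ≡⟨ ⇒-zeroʳ (y ⇒ x) ⟩
    one                  ∎

  ≤⇒⇒⊙≤ : ∀ {x y z} → x ≤ y ⇒ z → x ⊙ y ≤ z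
  ≤⇒⇒⊙≤ {x} {y} {z} = trans (⇒-curry x y z)

  ⊙≤⇒≤⇝ : ∀ {x y z} → x ⊙ y ≤ z → y ≤ x ⇝ z
  ⊙≤⇒≤⇝ {x} {y} {z} xy≤z = ⇝≡one⇒≤ (trans (sym (⇝-curry x y z)) (≤⇒⇝≡one xy≤z))

  ≤⇝⇒⊙≤ : ∀ {x y z} → y ≤ x ⇝ z → x ⊙ y ≤ z
  ≤⇝⇒⊙≤ {x} {y} {z} y≤x⇝z = ⇝≡one⇒≤ (trans (⇝-curry x y z) (≤⇒⇝≡one y≤x⇝z))

  x⊙y≡one⇒x≡one : ∀ {x y} → x ⊙ y ≡ one → x ≡ one
  x⊙y≡one⇒x≡one {x} {y} xy≡one = begin
    x            ≡⟨ ⇒-identityˡ x ⟨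
    one ⇒ x      ≡⟨ cong (_⇒ x) xy≡one ⟨
    (x ⊙ y) ⇒ x  ≡⟨ ≤⇝⇒⊙≤ y≤x⇝x ⟩
    one          ∎
    where
    y≤x⇝x : y ≤ x ⇝ x
    y≤x⇝x = trans (cong (y ⇒_) (⇝-refl x)) (⇒-zeroʳ y)

  x≤x∨₁y : ∀ x y → x ≤ x ∨₁ y
  x≤x∨₁y x y = ⊙≤⇒≤⇝ (≤⇒⇒⊙≤ (≤-refl (x ⇒ y)))

  x≤y⇒x∨₁y≡y : ∀ {x y} → x ≤ y → x ∨₁ y ≡ y
  x≤y⇒x∨₁y≡y {x} {y} x≤y = trans (cong (_⇝ y) x≤y) (⇝-identityˡ y)

  [x∨₁y]⇒y≡x⇒y : ∀ x y → (x ∨₁ y) ⇒ y ≡ x ⇒ y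
  [x∨₁y]⇒y≡x⇒y x y = ≤-antisym
    (trans (sym (⇒-curry (w ⇒ y) x y)) (≤⇝⇒⊙≤ (≤-trans (x≤x∨₁y x y) (x≤x∨₁y w y))))
    (trans (sym (⇒-curry (x ⇒ y) w y)) (≤⇝⇒⊙≤ (≤-refl w)))
    where
    w = x ∨₁ y

  [x∨₁y⇒x]⇒[x⇒y]≡x⇒y : ∀ x y → ((x ∨₁ y) ⇒ x) ⇒ (x ⇒ y) ≡ x ⇒ y
  [x∨₁y⇒x]⇒[x⇒y]≡x⇒y x y = begin
    (w ⇒ x) ⇒ (x ⇒ y)  ≡⟨ cong ((w ⇒ x) ⇒_) ([x∨₁y]⇒y≡x⇒y x y) ⟨
    (w ⇒ x) ⇒ (w ⇒ y)  ≡⟨ ⇒-curry (w ⇒ x) w y ⟨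
    ((w ⇒ x) ⊙ w) ⇒ y  ≡⟨ cong (_⇒ y) (x≤y⇒[y⇒x]⊙y≡x (x≤x∨₁y x y)) ⟩
    x ⇒ y              ∎
    where
    w = x ∨₁ y

  opposite-linear : IsLinear A → IsLinear (opposite A)
  opposite-linear linear x y = map ≤⇒⇝≡one ≤⇒⇝≡one (linear x y)

  ∨₁-comm∧linear⇒⇒-archimedean : Commutative _∨₁_ → IsLinear A → ⇒-Archimedean
  ∨₁-comm∧linear⇒⇒-archimedean ∨₁-comm linear x y y⇒x≡x with linear x y
  ... | inj₂ y≤x = inj₁ (trans (sym y⇒x≡x) y≤x)
  ... | inj₁ x≤y = inj₂ (begin
    y            ≡⟨ x≤y⇒x∨₁y≡y x≤y ⟨
    x ∨₁ y       ≡⟨ ∨₁-comm x y ⟩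
    (y ⇒ x) ⇝ x  ≡⟨ cong (_⇝ x) y⇒x≡x ⟩
    x ⇝ x        ≡⟨ ⇝-refl x ⟩
    one          ∎)

  module _ (archimedean : IsArchimedean A) where

    x≤y⊎x∨₁y≡x : ∀ x y → x ≤ y ⊎ x ∨₁ y ≡ x
    x≤y⊎x∨₁y≡x x y =
      map₂ (λ x∨₁y≤x → ≤-antisym x∨₁y≤x (x≤x∨₁y x y))
           (proj₁ archimedean (x ⇒ y) ((x ∨₁ y) ⇒ x) ([x∨₁y⇒x]⇒[x⇒y]≡x⇒y x y))

    x≤y⇒y∨₁x≡y : ∀ {x y} → x ≤ y → y ∨₁ x ≡ y
    x≤y⇒y∨₁x≡y {x} {y} x≤y with x≤y⊎x∨₁y≡x y x
    ... | inj₁ y≤x = trans (x≤y⇒x∨₁y≡y y≤x) (≤-antisym x≤y y≤x)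
    ... | inj₂ y∨₁x≡y = y∨₁x≡y

    x∨₁y≡x⇒y∨₁x≡y⇒x≤y : ∀ {x y} → x ∨₁ y ≡ x → y ∨₁ x ≡ y → x ≤ y
    x∨₁y≡x⇒y∨₁x≡y⇒x≤y {x} {y} x∨₁y≡x y∨₁x≡y =
      [ (λ y≡one → subst (x ≤_) (sym y≡one) (⇒-zeroʳ x)) , x⊙y≡one⇒x≡one ]′
        (proj₂ archimedean y ((x ⇒ y) ⊙ (y ⇒ x)) fixed)
      where
      fixed : ((x ⇒ y) ⊙ (y ⇒ x)) ⇝ y ≡ y
      fixed = begin
        ((x ⇒ y) ⊙ (y ⇒ x)) ⇝ y  ≡⟨ ⇝-curry (x ⇒ y) (y ⇒ x) y ⟩
        (y ⇒ x) ⇝ (x ∨₁ y)       ≡⟨ cong ((y ⇒ x) ⇝_) x∨₁y≡x ⟩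
        y ∨₁ x                   ≡⟨ y∨₁x≡y ⟩
        y                        ∎

    linear : IsLinear A
    linear x y with x≤y⊎x∨₁y≡x x y | x≤y⊎x∨₁y≡x y x
    ... | inj₁ x≤y    | _           = inj₁ x≤y
    ... | inj₂ _      | inj₁ y≤x    = inj₂ y≤x
    ... | inj₂ x∨₁y≡x | inj₂ y∨₁x≡y = inj₁ (x∨₁y≡x⇒y∨₁x≡y⇒x≤y x∨₁y≡x y∨₁x≡y)

    ∨₁-comm : Commutative _∨₁_
    ∨₁-comm x y with linear x y
    ... | inj₁ x≤y = trans (x≤y⇒x∨₁y≡y x≤y) (sym (x≤y⇒y∨₁x≡y x≤y))
    ... | inj₂ y≤x = trans (x≤y⇒y∨₁x≡y y≤x) (sym (x≤y⇒x∨₁y≡y y≤x))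

theorem3p20 : {a : Level} (A : PseudoHoop a) →
    IsArchimedean A ⇔ (IsWajsberg A × IsLinear A)
theorem3p20 A = mk⇔
  (λ arch → (P.∨₁-comm arch , Pᵒᵖ.∨₁-comm (swap arch)) , P.linear arch)
  (λ ((comm₁ , comm₂) , lin) →
     P.∨₁-comm∧linear⇒⇒-archimedean comm₁ lin ,
     Pᵒᵖ.∨₁-comm∧linear⇒⇒-archimedean comm₂ (P.opposite-linear lin))
  where
  module P = Properties A
  module Pᵒᵖ = Properties (opposite A)
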